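{- (Interaction of initial pushouts with pullbacks.) Let $(\mathcal{C},\mathcal{M})$ be an $\mathcal{M}$-adhesive category. Let $f_1:A_1\to A_2$, and let $(1)$ be the initial pushout over $f_1$, given by $b_{f_1}:B_{f_1}\to A_1$, $c_{f_1}:C_{f_1}\to A_2$, $x_{f_1}:B_{f_1}\to C_{f_1}$. Let $(2)$ be a pullback square $f_2\circ a_1=a_2\circ f_1$ with $a_1:A_1\to A_3$, $a_2:A_2\to A_4$, $f_2:A_3\to A_4$ and $a_2\in\mathcal{M}$. Let $(3)$ be a pushout square $f_2\circ a_3=a_4\circ f_3$ with $a_3:A_5\to A_3$, $f_3:A_5\to A_6$, $a_4:A_6\to A_4$ and $a_3\in\mathcal{M}$. Then there are unique $\mathcal{M}$-morphisms $d:B_{f_1}\to A_5$ and $e:C_{f_1}\to A_6$ with $a_3\circ d=a_1\circ b_{f_1}$ and $a_4\circ e=a_2\circ c_{f_1}$, and the induced square $f_3\circ d=e\circ x_{f_1}$ is a pullback.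
   Context: $\mathcal{M}$-adhesive category: $\mathcal{M}$ is a class of monomorphisms containing all isomorphisms, closed under composition and decomposition, pushouts and pullbacks along $\mathcal{M}$-morphisms exist and preserve $\mathcal{M}$, and pushouts along $\mathcal{M}$-morphisms are vertical weak van Kampen squares. Initial pushout over $f:A\to A'$: a pushout square with $b_f:B_f\to A$, $c_f:C_f\to A'$ in $\mathcal{M}$ and $x_f:B_f\to C_f$, $f\circ b_f=c_f\circ x_f$, such that for every pushout square $b:B\to A$, $c:C\to A'$, $x:B\to C$ over $f$ with $b,c\in\mathcal{M}$ there exist unique $b^*:B_f\to B$, $c^*:C_f\to C$ with $b\circ b^*=b_f$, $c\circ c^*=c_f$ and the square formed by $b^*,x_f,x,c^*$ a pushout. -}

module Defs where

open import Level using (Level; _⊔_; suc)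
open import Data.Product using (Σ; _×_; _,_; ∃-syntax)
open import Relation.Binary.PropositionalEquality using (_≡_)

record Category (o ℓ : Level) : Set (suc (o ⊔ ℓ)) where
  infixr 9 _∘_
  field
    Obj   : Set o
    Hom   : Obj → Obj → Set ℓ
    id    : ∀ {A} → Hom A A
    _∘_   : ∀ {A B C} → Hom B C → Hom A B → Hom A C
    assoc : ∀ {A B C D} (h : Hom C D) (g : Hom B C) (f : Hom A B) →
            (h ∘ g) ∘ f ≡ h ∘ (g ∘ f)
    idˡ   : ∀ {A B} (f : Hom A B) → id ∘ f ≡ f
    idʳ   : ∀ {A B} (f : Hom A B) → f ∘ id ≡ f

module _ {o ℓ : Level} (𝒞 : Category o ℓ) where
  open Category 𝒞

  IsMono : ∀ {A B} → Hom A B → Set (o ⊔ ℓ)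
  IsMono {A} {B} m = ∀ {X} (g h : Hom X A) → m ∘ g ≡ m ∘ h → g ≡ h

  IsIso : ∀ {A B} → Hom A B → Set ℓ
  IsIso {A} {B} f = Σ (Hom B A) λ g → (g ∘ f ≡ id) × (f ∘ g ≡ id)

  -- The square   P --q--> Y
  --              |p       |k
  --              X --h--> Z      with  h ∘ p ≡ k ∘ q   is a pullback.
  record IsPullback {P X Y Z : Obj} (p : Hom P X) (q : Hom P Y)
                    (h : Hom X Z) (k : Hom Y Z) : Set (o ⊔ ℓ) where
    field
      commutes  : h ∘ p ≡ k ∘ q
      universal : ∀ {Q} (u : Hom Q X) (v : Hom Q Y) → h ∘ u ≡ k ∘ v →
                  Hom Q P
      factorˡ   : ∀ {Q} (u : Hom Q X) (v : Hom Q Y) (eq : h ∘ u ≡ k ∘ v) →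
                  p ∘ universal u v eq ≡ u
      factorʳ   : ∀ {Q} (u : Hom Q X) (v : Hom Q Y) (eq : h ∘ u ≡ k ∘ v) →
                  q ∘ universal u v eq ≡ v
      unique    : ∀ {Q} (u : Hom Q X) (v : Hom Q Y) (eq : h ∘ u ≡ k ∘ v)
                  (w : Hom Q P) → p ∘ w ≡ u → q ∘ w ≡ v →
                  w ≡ universal u v eq

  -- The square   Z --k--> Y
  --              |h       |q
  --              X --p--> P      with  p ∘ h ≡ q ∘ k  is a pushout.
  record IsPushout {Z X Y P : Obj} (h : Hom Z X) (k : Hom Z Y)
                   (p : Hom X P) (q : Hom Y P) : Set (o ⊔ ℓ) where
    field
      commutes  : p ∘ h ≡ q ∘ k
      universal : ∀ {Q} (u : Hom X Q) (v : Hom Y Q) → u ∘ h ≡ v ∘ k →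
                  Hom P Q
      factorˡ   : ∀ {Q} (u : Hom X Q) (v : Hom Y Q) (eq : u ∘ h ≡ v ∘ k) →
                  universal u v eq ∘ p ≡ u
      factorʳ   : ∀ {Q} (u : Hom X Q) (v : Hom Y Q) (eq : u ∘ h ≡ v ∘ k) →
                  universal u v eq ∘ q ≡ v
      unique    : ∀ {Q} (u : Hom X Q) (v : Hom Y Q) (eq : u ∘ h ≡ v ∘ k)
                  (w : Hom P Q) → w ∘ p ≡ u → w ∘ q ≡ v →
                  w ≡ universal u v eq

record MAdhesive (o ℓ m : Level) : Set (suc (o ⊔ ℓ ⊔ m)) where
  field
    𝒞 : Category o ℓ
  open Category 𝒞
  field
    M          : ∀ {A B} → Hom A B → Set m
    M-mono     : ∀ {A B} (f : Hom A B) → M f → IsMono 𝒞 f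
    M-iso      : ∀ {A B} (f : Hom A B) → IsIso 𝒞 f → M f
    M-comp     : ∀ {A B C} (g : Hom B C) (f : Hom A B) → M g → M f → M (g ∘ f)
    M-decomp   : ∀ {A B C} (g : Hom B C) (f : Hom A B) → M (g ∘ f) → M g → M f
    pushout    : ∀ {A B C} (m : Hom A B) (f : Hom A C) → M m →
                 Σ Obj λ D → Σ (Hom B D) λ g → Σ (Hom C D) λ n →
                   IsPushout 𝒞 m f g n
    pushout-M  : ∀ {A B C D} (m : Hom A B) (f : Hom A C) (g : Hom B D)
                 (n : Hom C D) → IsPushout 𝒞 m f g n → M m → M n
    pullback   : ∀ {B C D} (g : Hom B D) (n : Hom C D) → M n →
                 Σ Obj λ A → Σ (Hom A B) λ m → Σ (Hom A C) λ f →
                   IsPullback 𝒞 m f g n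
    pullback-M : ∀ {A B C D} (m : Hom A B) (f : Hom A C) (g : Hom B D)
                 (n : Hom C D) → IsPullback 𝒞 m f g n → M n → M m
    -- pushouts along M-morphisms are vertical weak van Kampen squares:
    -- bottom face  A --f--> C, A --m--> B, B --g--> D, C --n--> D (pushout, m ∈ M);
    -- top face     A' --f'--> C', A' --m'--> B', B' --g'--> D', C' --n'--> D';
    -- vertical     a : A' → A, b : B' → B, c : C' → C, d : D' → D with b, c, d ∈ M;
    -- cube commutes, back faces are pullbacks.
    vertical-weak-VK :
      ∀ {A B C D A' B' C' D'}
        (m : Hom A B) (f : Hom A C) (g : Hom B D) (n : Hom C D) →
        IsPushout 𝒞 m f g n → M m →
        (m' : Hom A' B') (f' : Hom A' C') (g' : Hom B' D') (n' : Hom C' D')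
        (a : Hom A' A) (b : Hom B' B) (c : Hom C' C) (d : Hom D' D) →
        M b → M c → M d →
        g' ∘ m' ≡ n' ∘ f' →
        g ∘ b ≡ d ∘ g' →
        n ∘ c ≡ d ∘ n' →
        IsPullback 𝒞 a m' m b →
        IsPullback 𝒞 a f' f c →
        (IsPushout 𝒞 m' f' g' n' →
           IsPullback 𝒞 b g' g d × IsPullback 𝒞 c n' n d)
        × (IsPullback 𝒞 b g' g d → IsPullback 𝒞 c n' n d →
           IsPushout 𝒞 m' f' g' n')

module _ {o ℓ m : Level} (𝒜 : MAdhesive o ℓ m) where
  open MAdhesive 𝒜
  open Category 𝒞

  record IsInitialPushout {A A' B C : Obj} (f : Hom A A')
         (b : Hom B A) (c : Hom C A') (x : Hom B C) : Set (o ⊔ ℓ ⊔ m) where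
    field
      b∈M      : M b
      c∈M      : M c
      pushout  : IsPushout 𝒞 b x f c
      initial  : ∀ {B' C'} (b' : Hom B' A) (c' : Hom C' A') (x' : Hom B' C') →
                 M b' → M c' → IsPushout 𝒞 b' x' f c' →
                 Σ (Hom B B') λ b* → Σ (Hom C C') λ c* →
                   (b' ∘ b* ≡ b) × (c' ∘ c* ≡ c) × IsPushout 𝒞 b* x x' c*
                   × (∀ (b** : Hom B B') (c** : Hom C C') →
                        b' ∘ b** ≡ b → c' ∘ c** ≡ c →
                        IsPushout 𝒞 b** x x' c** → (b** ≡ b*) × (c** ≡ c*))

-- Pull the pushout (3) back to P = A₅ ×_{A₃} A₁ and Q = A₆ ×_{A₄} A₂. By pullback pasting
-- through (2) the back face P → Q over f₃ is a pullback, so by the van Kampen property the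
-- top face P → Q over f₁ is a pushout along M. The initial pushout over f₁ factors through it
-- by M-morphisms b*, c*; the factor square is a pushout along M, hence a pullback, and pasting
-- it with the back face gives the required pullback with d = q ∘ b* and e = s ∘ c*.
-- Uniqueness holds because a₃ and a₄ are monic.
module Submission where

open import Defs
open import Level using (Level; _⊔_)
open import Data.Product using (Σ; _×_; _,_; proj₁; proj₂)
open import Relation.Binary.PropositionalEquality
  using (_≡_; refl; sym; trans; cong; subst; module ≡-Reasoning)

module PullbackLemmas {o ℓ : Level} (𝒞 : Category o ℓ) where
  open Category 𝒞
  open ≡-Reasoning

  extendˡ : ∀ {P X Y Z W} {p : Hom P X} {q : Hom P Y} {h : Hom X Z} {k : Hom Y Z}
            {w : Hom W P} → h ∘ p ≡ k ∘ q → h ∘ (p ∘ w) ≡ k ∘ (q ∘ w)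
  extendˡ {p = p} {q} {h} {k} {w} sq = begin
    h ∘ (p ∘ w)  ≡⟨ sym (assoc h p w) ⟩
    (h ∘ p) ∘ w  ≡⟨ cong (_∘ w) sq ⟩
    (k ∘ q) ∘ w  ≡⟨ assoc k q w ⟩
    k ∘ (q ∘ w)  ∎

  pullback-swap : ∀ {P X Y Z} {p : Hom P X} {q : Hom P Y} {h : Hom X Z} {k : Hom Y Z} →
                  IsPullback 𝒞 p q h k → IsPullback 𝒞 q p k h
  pullback-swap pb = record
    { commutes  = sym commutes
    ; universal = λ u v eq → universal v u (sym eq)
    ; factorˡ   = λ u v eq → factorʳ v u (sym eq)
    ; factorʳ   = λ u v eq → factorˡ v u (sym eq)
    ; unique    = λ u v eq w p∘w q∘w → unique v u (sym eq) w q∘w p∘w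
    }
    where open IsPullback pb

  pullback-jointly-monic :
    ∀ {P X Y Z W} {p : Hom P X} {q : Hom P Y} {h : Hom X Z} {k : Hom Y Z} →
    IsPullback 𝒞 p q h k → (w w′ : Hom W P) → p ∘ w ≡ p ∘ w′ → q ∘ w ≡ q ∘ w′ → w ≡ w′
  pullback-jointly-monic {p = p} {q} pb w w′ p∘w q∘w = trans
    (unique (p ∘ w′) (q ∘ w′) (extendˡ commutes) w p∘w q∘w)
    (sym (unique (p ∘ w′) (q ∘ w′) (extendˡ commutes) w′ refl refl))
    where open IsPullback pb

  --  P --q₁--> Y
  --  |p₁       |k₁
  --  X --h₁--> Z
  --  |p₂       |k₂
  --  X′ --h₂-> Z′
  pullback-paste :
    ∀ {P X Y Z X′ Z′} {p₁ : Hom P X} {q₁ : Hom P Y} {h₁ : Hom X Z} {k₁ : Hom Y Z}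
      {p₂ : Hom X X′} {h₂ : Hom X′ Z′} {k₂ : Hom Z Z′} →
    IsPullback 𝒞 p₁ q₁ h₁ k₁ → IsPullback 𝒞 p₂ h₁ h₂ k₂ →
    IsPullback 𝒞 (p₂ ∘ p₁) q₁ h₂ (k₂ ∘ k₁)
  pullback-paste {X = X} {Y = Y} {X′ = X′} {p₁ = p₁} {q₁} {h₁} {k₁} {p₂} {h₂} {k₂} upper lower = record
    { commutes  = begin
        h₂ ∘ (p₂ ∘ p₁)  ≡⟨ extendˡ L.commutes ⟩
        k₂ ∘ (h₁ ∘ p₁)  ≡⟨ cong (k₂ ∘_) U.commutes ⟩
        k₂ ∘ (k₁ ∘ q₁)  ≡⟨ sym (assoc k₂ k₁ q₁) ⟩
        (k₂ ∘ k₁) ∘ q₁  ∎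
    ; universal = λ u v eq → U.universal (middle u v eq) v (L.factorʳ u (k₁ ∘ v) (reassoc eq))
    ; factorˡ   = λ u v eq → begin
        (p₂ ∘ p₁) ∘ _   ≡⟨ assoc p₂ p₁ _ ⟩
        p₂ ∘ (p₁ ∘ _)   ≡⟨ cong (p₂ ∘_) (U.factorˡ _ v _) ⟩
        p₂ ∘ middle u v eq ≡⟨ L.factorˡ u (k₁ ∘ v) (reassoc eq) ⟩
        u               ∎
    ; factorʳ   = λ u v eq → U.factorʳ (middle u v eq) v _
    ; unique    = λ u v eq w p∘w q∘w →
        U.unique (middle u v eq) v _ w
          (L.unique u (k₁ ∘ v) (reassoc eq) (p₁ ∘ w)
             (trans (sym (assoc p₂ p₁ w)) p∘w)
             (trans (extendˡ U.commutes) (cong (k₁ ∘_) q∘w)))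
          q∘w
    }
    where
      module U = IsPullback upper
      module L = IsPullback lower
      reassoc : ∀ {Q} {u : Hom Q X′} {v : Hom Q Y} →
                h₂ ∘ u ≡ (k₂ ∘ k₁) ∘ v → h₂ ∘ u ≡ k₂ ∘ (k₁ ∘ v)
      reassoc {v = v} eq = trans eq (assoc k₂ k₁ v)
      middle : ∀ {Q} (u : Hom Q X′) (v : Hom Q Y) → h₂ ∘ u ≡ (k₂ ∘ k₁) ∘ v → Hom Q X
      middle u v eq = L.universal u (k₁ ∘ v) (reassoc eq)

  -- Same diagram as pullback-paste, with the outer rectangle's sides given as u and v.
  pullback-unpaste :
    ∀ {P X Y Z X′ Z′} {p₁ : Hom P X} {q₁ : Hom P Y} {h₁ : Hom X Z} {k₁ : Hom Y Z}
      {p₂ : Hom X X′} {h₂ : Hom X′ Z′} {k₂ : Hom Z Z′} {u : Hom P X′} {v : Hom Y Z′} →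
    IsPullback 𝒞 p₂ h₁ h₂ k₂ → IsPullback 𝒞 u q₁ h₂ v →
    p₂ ∘ p₁ ≡ u → k₂ ∘ k₁ ≡ v → h₁ ∘ p₁ ≡ k₁ ∘ q₁ → IsPullback 𝒞 p₁ q₁ h₁ k₁
  pullback-unpaste {P = P} {X = X} {Y = Y} {p₁ = p₁} {q₁} {h₁} {k₁} {p₂} {h₂} {k₂} {u} {v}
                   lower outer p₂∘p₁ k₂∘k₁ sq = record
    { commutes  = sq
    ; universal = λ a b eq → O.universal (p₂ ∘ a) b (outer-commutes eq)
    ; factorˡ   = λ a b eq → pullback-jointly-monic lower _ a
        (trans (through-u _) (O.factorˡ (p₂ ∘ a) b (outer-commutes eq)))
        (begin
          h₁ ∘ (p₁ ∘ _)  ≡⟨ extendˡ sq ⟩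
          k₁ ∘ (q₁ ∘ _)  ≡⟨ cong (k₁ ∘_) (O.factorʳ (p₂ ∘ a) b (outer-commutes eq)) ⟩
          k₁ ∘ b         ≡⟨ sym eq ⟩
          h₁ ∘ a         ∎)
    ; factorʳ   = λ a b eq → O.factorʳ (p₂ ∘ a) b (outer-commutes eq)
    ; unique    = λ a b eq w p₁∘w q₁∘w →
        O.unique (p₂ ∘ a) b (outer-commutes eq) w
          (trans (sym (through-u w)) (cong (p₂ ∘_) p₁∘w)) q₁∘w
    }
    where
      module O = IsPullback outer
      through-u : ∀ {Q} (w : Hom Q P) → p₂ ∘ (p₁ ∘ w) ≡ u ∘ w
      through-u w = trans (sym (assoc p₂ p₁ w)) (cong (_∘ w) p₂∘p₁)
      outer-commutes : ∀ {Q} {a : Hom Q X} {b : Hom Q Y} →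
                       h₁ ∘ a ≡ k₁ ∘ b → h₂ ∘ (p₂ ∘ a) ≡ v ∘ b
      outer-commutes {a = a} {b} eq = begin
        h₂ ∘ (p₂ ∘ a)  ≡⟨ extendˡ (IsPullback.commutes lower) ⟩
        k₂ ∘ (h₁ ∘ a)  ≡⟨ cong (k₂ ∘_) eq ⟩
        k₂ ∘ (k₁ ∘ b)  ≡⟨ sym (assoc k₂ k₁ b) ⟩
        (k₂ ∘ k₁) ∘ b  ≡⟨ cong (_∘ b) k₂∘k₁ ⟩
        v ∘ b          ∎

  mono⇒kernel-pair-id : ∀ {A B} (m : Hom A B) → IsMono 𝒞 m → IsPullback 𝒞 id id m m
  mono⇒kernel-pair-id m mono = record
    { commutes  = refl
    ; universal = λ u v eq → u
    ; factorˡ   = λ u v eq → idˡ u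
    ; factorʳ   = λ u v eq → trans (idˡ u) (mono u v eq)
    ; unique    = λ u v eq w id∘w _ → trans (sym (idˡ w)) id∘w
    }

  id-pullback : ∀ {A C} (f : Hom A C) → IsPullback 𝒞 id f f id
  id-pullback f = record
    { commutes  = trans (idʳ f) (sym (idˡ f))
    ; universal = λ u v eq → u
    ; factorˡ   = λ u v eq → idˡ u
    ; factorʳ   = λ u v eq → trans eq (idˡ v)
    ; unique    = λ u v eq w id∘w _ → trans (sym (idˡ w)) id∘w
    }

  id-pushout : ∀ {A C} (f : Hom A C) → IsPushout 𝒞 id f f id
  id-pushout f = record
    { commutes  = trans (idʳ f) (sym (idˡ f))
    ; universal = λ u v eq → v
    ; factorˡ   = λ u v eq → trans (sym eq) (idʳ u)
    ; factorʳ   = λ u v eq → idʳ v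
    ; unique    = λ u v eq w _ w∘id → trans (sym (idʳ w)) w∘id
    }

module MAdhesiveLemmas {o ℓ m : Level} (𝒜 : MAdhesive o ℓ m) where
  open MAdhesive 𝒜
  open Category 𝒞
  open PullbackLemmas 𝒞

  pullback-M-swap : ∀ {P X Y Z} {p : Hom P X} {q : Hom P Y} {h : Hom X Z} {k : Hom Y Z} →
                    IsPullback 𝒞 p q h k → M h → M q
  pullback-M-swap {p = p} {q} {h} {k} pb = pullback-M q p k h (pullback-swap pb)

  -- Van Kampen applied to the trivial cube whose top face is the identity pushout on f.
  pushout-along-M-is-pullback :
    ∀ {A B C D} {m′ : Hom A B} {f : Hom A C} {g : Hom B D} {n : Hom C D} →
    IsPushout 𝒞 m′ f g n → M m′ → IsPullback 𝒞 m′ f g n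
  pushout-along-M-is-pullback {m′ = m′} {f} {g} {n} po m′∈M =
    proj₁ (proj₁ (vertical-weak-VK m′ f g n po m′∈M id f f id id m′ id n
      m′∈M (M-iso id (id , idˡ id , idˡ id)) (pushout-M m′ f g n po m′∈M)
      (IsPushout.commutes (id-pushout f)) (IsPushout.commutes po) refl
      (mono⇒kernel-pair-id m′ (M-mono m′ m′∈M)) (id-pullback f))
      (id-pushout f))

  -- P = A₅ ×_{A₃} A₁ and Q = A₆ ×_{A₄} A₂, forming a cube over the pushout a₃, f₃, f₂, a₄.
  record RestrictedPushout {A₁ A₂ A₃ A₄ A₅ A₆ : Obj}
      (f₁ : Hom A₁ A₂) (a₁ : Hom A₁ A₃) (a₂ : Hom A₂ A₄) (f₂ : Hom A₃ A₄)
      (a₃ : Hom A₅ A₃) (f₃ : Hom A₅ A₆) (a₄ : Hom A₆ A₄) : Set (o ⊔ ℓ ⊔ m) where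
    field
      {P Q}    : Obj
      p        : Hom P A₁
      q        : Hom P A₅
      r        : Hom Q A₂
      s        : Hom Q A₆
      f′       : Hom P Q
      p∈M      : M p
      q∈M      : M q
      r∈M      : M r
      s∈M      : M s
      a₃∘q≡a₁∘p : a₃ ∘ q ≡ a₁ ∘ p
      a₄∘s≡a₂∘r : a₄ ∘ s ≡ a₂ ∘ r
      back     : IsPullback 𝒞 q f′ f₃ s
      top      : IsPushout 𝒞 p f′ f₁ r

  restrict-pushout :
    ∀ {A₁ A₂ A₃ A₄ A₅ A₆} {f₁ : Hom A₁ A₂} {a₁ : Hom A₁ A₃} {a₂ : Hom A₂ A₄}
      {f₂ : Hom A₃ A₄} {a₃ : Hom A₅ A₃} {f₃ : Hom A₅ A₆} {a₄ : Hom A₆ A₄} →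
    IsPullback 𝒞 f₁ a₁ a₂ f₂ → M a₂ → IsPushout 𝒞 a₃ f₃ f₂ a₄ → M a₃ →
    RestrictedPushout f₁ a₁ a₂ f₂ a₃ f₃ a₄
  restrict-pushout {f₁ = f₁} {a₁} {a₂} {f₂} {a₃} {f₃} {a₄} pb₂ a₂∈M po₃ a₃∈M
    with pullback a₃ a₁ (pullback-M-swap pb₂ a₂∈M) | pullback a₄ a₂ a₂∈M
  ... | P , q , p , pbP | Q , s , r , pbQ = record
    { p = p ; q = q ; r = r ; s = s ; f′ = f′
    ; p∈M = pullback-M-swap pbP a₃∈M
    ; q∈M = pullback-M q p a₃ a₁ pbP a₁∈M
    ; r∈M = pullback-M-swap pbQ (pushout-M a₃ f₃ f₂ a₄ po₃ a₃∈M)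
    ; s∈M = s∈M
    ; a₃∘q≡a₁∘p = PBP.commutes
    ; a₄∘s≡a₂∘r = PBQ.commutes
    ; back = back
    ; top  = proj₂ (vertical-weak-VK a₃ f₃ f₂ a₄ po₃ a₃∈M p f′ f₁ r q a₁ s a₂
               a₁∈M s∈M a₂∈M
               (sym r∘f′) (sym (IsPullback.commutes pb₂)) PBQ.commutes pbP back)
               (pullback-swap pb₂) pbQ
    }
    where
      module PBP = IsPullback pbP
      module PBQ = IsPullback pbQ
      a₁∈M : M a₁
      a₁∈M = pullback-M-swap pb₂ a₂∈M
      s∈M : M s
      s∈M = pullback-M s r a₄ a₂ pbQ a₂∈M
      f₃q-square : a₄ ∘ (f₃ ∘ q) ≡ a₂ ∘ (f₁ ∘ p)
      f₃q-square = trans (sym (extendˡ (IsPushout.commutes po₃)))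
                     (trans (cong (f₂ ∘_) PBP.commutes) (sym (extendˡ (IsPullback.commutes pb₂))))
      f′ : Hom P Q
      f′ = PBQ.universal (f₃ ∘ q) (f₁ ∘ p) f₃q-square
      r∘f′ : r ∘ f′ ≡ f₁ ∘ p
      r∘f′ = PBQ.factorʳ (f₃ ∘ q) (f₁ ∘ p) f₃q-square
      -- P is the pullback of a₂ along f₂ ∘ a₃ = a₄ ∘ f₃, and Q that of a₂ along a₄.
      back : IsPullback 𝒞 q f′ f₃ s
      back = pullback-swap
        (pullback-unpaste (pullback-swap pbQ) (pullback-paste (pullback-swap pbP) pb₂)
           r∘f′ (sym (IsPushout.commutes po₃)) (PBQ.factorˡ (f₃ ∘ q) (f₁ ∘ p) f₃q-square))

  record InitialFactorisation {A A′ B C P Q : Obj}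
      (b : Hom B A) (c : Hom C A′) (x : Hom B C) (p : Hom P A) (r : Hom Q A′) (f′ : Hom P Q)
      : Set (o ⊔ ℓ ⊔ m) where
    field
      b*              : Hom B P
      c*              : Hom C Q
      b*∈M            : M b*
      c*∈M            : M c*
      p∘b*≡b          : p ∘ b* ≡ b
      r∘c*≡c          : r ∘ c* ≡ c
      factor-pullback : IsPullback 𝒞 b* x f′ c*

  initial-pushout-factorisation :
    ∀ {A A′ B C P Q} {f : Hom A A′} {b : Hom B A} {c : Hom C A′} {x : Hom B C}
      {p : Hom P A} {r : Hom Q A′} {f′ : Hom P Q} →
    IsInitialPushout 𝒜 f b c x → IsPushout 𝒞 p f′ f r → M p → M r →
    InitialFactorisation b c x p r f′
  initial-pushout-factorisation {p = p} {r} {f′} ip po p∈M r∈M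
    with IsInitialPushout.initial ip p r f′ p∈M r∈M po
  ... | b* , c* , p∘b*≡b , r∘c*≡c , po* , _ = record
    { b* = b* ; c* = c* ; b*∈M = b*∈M ; c*∈M = c*∈M
    ; p∘b*≡b = p∘b*≡b ; r∘c*≡c = r∘c*≡c
    ; factor-pullback = pushout-along-M-is-pullback po* b*∈M
    }
    where
      b*∈M : M b*
      b*∈M = M-decomp p b* (subst M (sym p∘b*≡b) (IsInitialPushout.b∈M ip)) p∈M
      c*∈M : M c*
      c*∈M = M-decomp r c* (subst M (sym r∘c*≡c) (IsInitialPushout.c∈M ip)) r∈M

lemma3 : ∀ {o ℓ m} (𝒜 : MAdhesive o ℓ m) →
    let open MAdhesive 𝒜 in let open Category 𝒞 in
    ∀ {A₁ A₂ A₃ A₄ A₅ A₆ B C : Obj}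
      (f₁ : Hom A₁ A₂) (b : Hom B A₁) (c : Hom C A₂) (x : Hom B C) →
      IsInitialPushout 𝒜 f₁ b c x →
      (a₁ : Hom A₁ A₃) (a₂ : Hom A₂ A₄) (f₂ : Hom A₃ A₄) →
      IsPullback 𝒞 f₁ a₁ a₂ f₂ → M a₂ →
      (a₃ : Hom A₅ A₃) (f₃ : Hom A₅ A₆) (a₄ : Hom A₆ A₄) →
      IsPushout 𝒞 a₃ f₃ f₂ a₄ → M a₃ →
      Σ (Hom B A₅) λ d → Σ (Hom C A₆) λ e →
        M d × M e × (a₃ ∘ d ≡ a₁ ∘ b) × (a₄ ∘ e ≡ a₂ ∘ c)
        × (∀ (d' : Hom B A₅) (e' : Hom C A₆) → M d' → M e' →
             a₃ ∘ d' ≡ a₁ ∘ b → a₄ ∘ e' ≡ a₂ ∘ c → (d' ≡ d) × (e' ≡ e))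
        × IsPullback 𝒞 d x f₃ e
lemma3 𝒜 f₁ b c x ip a₁ a₂ f₂ pb₂ a₂∈M a₃ f₃ a₄ po₃ a₃∈M =
  q ∘ b* , s ∘ c* , M-comp q b* q∈M b*∈M , M-comp s c* s∈M c*∈M , a₃∘d≡a₁∘b , a₄∘e≡a₂∘c
  , (λ d′ e′ _ _ a₃∘d′ a₄∘e′ →
       M-mono a₃ a₃∈M d′ (q ∘ b*) (trans a₃∘d′ (sym a₃∘d≡a₁∘b))
     , M-mono a₄ (pushout-M a₃ f₃ f₂ a₄ po₃ a₃∈M) e′ (s ∘ c*) (trans a₄∘e′ (sym a₄∘e≡a₂∘c)))
  , pullback-paste factor-pullback back
  where
    open MAdhesive 𝒜
    open Category 𝒞
    open PullbackLemmas 𝒞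
    open MAdhesiveLemmas 𝒜
    open RestrictedPushout (restrict-pushout pb₂ a₂∈M po₃ a₃∈M)
    open InitialFactorisation (initial-pushout-factorisation ip top p∈M r∈M)
    a₃∘d≡a₁∘b : a₃ ∘ (q ∘ b*) ≡ a₁ ∘ b
    a₃∘d≡a₁∘b = trans (extendˡ a₃∘q≡a₁∘p) (cong (a₁ ∘_) p∘b*≡b)
    a₄∘e≡a₂∘c : a₄ ∘ (s ∘ c*) ≡ a₂ ∘ c
    a₄∘e≡a₂∘c = trans (extendˡ a₄∘s≡a₂∘r) (cong (a₂ ∘_) r∘c*≡c)
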